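{- For every $n\times n$ matrix $L$ ($n\ge 2$) with non-negative integer entries and zero diagonal, the recursive procedure $\mathsf{A}$ described below outputs exactly the set $\min\mathcal{D}_{\ge 0}(L)$. Procedure $\mathsf{A}(L)$: If $n=2$, $L=\begin{pmatrix}0&a\\ b&0\end{pmatrix}$, output $\min\{(d,\max(1,\lceil ab/d\rceil)) \mid d\in\mathbb{N}_+,\ d\le\max(1,ab)\}$. If $n\ge 3$: (1) for each $s\in\{1,\ldots,n\}$ compute recursively $\tilde A_s=\mathsf{A}(L_s)$; (2) let $A_s=\{\tilde{\mathbf{d}}_s \mid \tilde{\mathbf{d}}\in\tilde A_s\}$; (3) for each tuple $(\boldsymbol\delta_1,\ldots,\boldsymbol\delta_n)\in A_1\times\cdots\times A_n$, let $\mathbf{d}$ be the componentwise maximum of $\boldsymbol\delta_1,\ldots,\boldsymbol\delta_n$; (4) compute the set $E_{\mathbf d}$ of minimal vectors $\mathbf{e}\ge\mathbf{d}$ in $\mathbb{N}_+^n$ such that all proper principal minors of $\mathrm{Diag}(\mathbf{e})-L$ are positive (equivalently, all non-constant coefficients of $\det(\mathrm{Diag}(X+\mathbf{e})-L)$ are positive); (5) for each $\mathbf{e}\in E_{\mathbf d}$, compute the minimal vectors $\mathbf{e}'\ge\mathbf{e}$ such that $\det(\mathrm{Diag}(\mathbf{e}')-L)\ge 0$; (6) output the set of minimal elements of the union, over all tuples in (3) and all $\mathbf{e}$ in (4), of the vectors found in (5).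
   Context: $\mathbb{N}_+$ denotes the positive integers. A real square Z-matrix (off-diagonal entries $\le 0$) is an almost non-singular $M$-matrix if all its proper principal minors are positive and its determinant is non-negative. $\mathcal{D}_{\ge 0}(L)=\{\mathbf{d}\in\mathbb{N}_+^n \mid \mathrm{Diag}(\mathbf{d})-L \text{ is an almost non-singular } M\text{ -matrix}\}$. For $S\subseteq\mathbb{N}^n$, $\min S$ denotes its set of minimal elements under the componentwise order ($\mathbf{x}\le\mathbf{y}$ iff $x_i\le y_i$ for all $i$). $L_s$ is the matrix obtained from $L$ by deleting its $s$-th row and column. For $\mathbf{d}\in\mathbb{Z}^{n-1}$ and $1\le s\le n$, $\mathbf{d}_s\in\mathbb{Z}^n$ is obtained by inserting the entry $1$ at position $s$: $\mathbf{d}_s[i]=\mathbf{d}[i]$ for $i<s$, $\mathbf{d}_s[s]=1$, $\mathbf{d}_s[i]=\mathbf{d}[i-1]$ for $i>s$. $X=(x_1,\ldots,x_n)$ is a vector of variables. -}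

module Defs where

open import Level using (0ℓ)
open import Data.Nat as ℕ using (ℕ; zero; suc; _⊔_; _*_; _+_)
open import Data.Nat.DivMod using (_/_)
open import Data.Integer as ℤ using (ℤ; +_; 0ℤ; 1ℤ)
open import Data.Fin as Fin using (Fin; punchIn)
open import Data.Vec as Vec using (Vec; []; _∷_; lookup; tabulate; insertAt)
open import Data.Vec.Relation.Binary.Pointwise.Inductive using (Pointwise)
open import Data.Product using (Σ; ∃; _×_; _,_)
open import Relation.Binary.PropositionalEquality using (_≡_; _≢_)
open import Relation.Unary using (Pred)
open import Relation.Nullary using (yes; no)

Matrix : Set → ℕ → Set
Matrix A n = Fin n → Fin n → A

∑ : ∀ {n} → (Fin n → ℤ) → ℤ
∑ {zero}  f = 0ℤ
∑ {suc n} f = f Fin.zero ℤ.+ ∑ (λ i → f (Fin.suc i))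

sgn : ℕ → ℤ
sgn zero          = 1ℤ
sgn (suc zero)    = ℤ.- 1ℤ
sgn (suc (suc k)) = sgn k

det : ∀ {n} → Matrix ℤ n → ℤ
det {zero}  M = 1ℤ
det {suc n} M = ∑ (λ j → sgn (Fin.toℕ j) ℤ.* (M Fin.zero j ℤ.* det (λ i k → M (Fin.suc i) (punchIn j k))))

IsZMatrix : ∀ {n} → Matrix ℤ n → Set
IsZMatrix M = ∀ i j → i ≢ j → M i j ℤ.≤ 0ℤ

StrictlyIncreasing : ∀ {k n} → (Fin k → Fin n) → Set
StrictlyIncreasing σ = ∀ i j → i Fin.< j → σ i Fin.< σ j

principalSub : ∀ {k n} → (Fin k → Fin n) → Matrix ℤ n → Matrix ℤ k
principalSub σ M i j = M (σ i) (σ j)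

ProperMinorsPositive : ∀ {n} → Matrix ℤ n → Set
ProperMinorsPositive {n} M =
  ∀ k → k ℕ.< n → (σ : Fin k → Fin n) → StrictlyIncreasing σ → 0ℤ ℤ.< det (principalSub σ M)

IsAlmostNonsingularM : ∀ {n} → Matrix ℤ n → Set
IsAlmostNonsingularM M = IsZMatrix M × ProperMinorsPositive M × 0ℤ ℤ.≤ det M

DiagMinus : ∀ {n} → Vec ℕ n → Matrix ℕ n → Matrix ℤ n
DiagMinus d L i j with i Fin.≟ j
... | yes _ = + lookup d i ℤ.- + L i j
... | no _ = ℤ.- (+ L i j)

_≤ᵥ_ : ∀ {n} → Vec ℕ n → Vec ℕ n → Set
_≤ᵥ_ = Pointwise ℕ._≤_

Positive : ∀ {n} → Vec ℕ n → Set
Positive d = ∀ i → 1 ℕ.≤ lookup d i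

Min : ∀ {n} → Pred (Vec ℕ n) 0ℓ → Pred (Vec ℕ n) 0ℓ
Min P x = P x × (∀ y → P y → y ≤ᵥ x → y ≡ x)

D≥0 : ∀ {n} → Matrix ℕ n → Pred (Vec ℕ n) 0ℓ
D≥0 L d = Positive d × IsAlmostNonsingularM (DiagMinus d L)

delRC : ∀ {n} → Fin (suc n) → Matrix ℕ (suc n) → Matrix ℕ n
delRC s L i j = L (punchIn s i) (punchIn s j)

maxFin : ∀ {n} → (Fin n → ℕ) → ℕ
maxFin {zero}  f = 0
maxFin {suc n} f = f Fin.zero ⊔ maxFin (λ i → f (Fin.suc i))

cmax : ∀ {m n} → (Fin m → Vec ℕ n) → Vec ℕ n
cmax δ = tabulate (λ i → maxFin (λ s → lookup (δ s) i))

Eset : ∀ {n} → Matrix ℕ n → Vec ℕ n → Pred (Vec ℕ n) 0ℓ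
Eset L d = Min (λ e → d ≤ᵥ e × Positive e × ProperMinorsPositive (DiagMinus e L))

Fset : ∀ {n} → Matrix ℕ n → Vec ℕ n → Pred (Vec ℕ n) 0ℓ
Fset L e = Min (λ e' → e ≤ᵥ e' × 0ℤ ℤ.≤ det (DiagMinus e' L))

-- Procedure A on (2+n)×(2+n) matrices, outputs a set (predicate).
-- ⌈ab/d⌉ with d = suc k is (ab + k) / suc k.
procA : ∀ n → Matrix ℕ (2 + n) → Pred (Vec ℕ (2 + n)) 0ℓ
procA zero L = Min (λ v → ∃ λ k → suc k ℕ.≤ (1 ⊔ (a * b)) ×
                     v ≡ suc k ∷ (1 ⊔ ((a * b + k) / suc k)) ∷ [])
  where
    a = L Fin.zero (Fin.suc Fin.zero)
    b = L (Fin.suc Fin.zero) Fin.zero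
procA (suc n) L = Min (λ v →
  Σ (Fin (3 + n) → Vec ℕ (3 + n)) λ δ →
    (∀ s → ∃ λ d̃ → procA n (delRC s L) d̃ × δ s ≡ insertAt d̃ s 1) ×
    ∃ λ e → Eset L (cmax δ) e × Fset L e v)

module Submission where

-- Raising d_i by one adds to det(Diag(d) - L) its
-- principal minor without row and column i (cofactor expansion along the unit entry), so these
-- conditions, and those of steps (4) and (5), define decidable upward closed sets of vectors;
-- every member of such a set lies above a minimal member.
--
-- Both sides of the theorem are sets of minimal elements, so it suffices that every candidate
-- minimised in the last step of A(L) lies in 𝒟≥0(L), which is immediate, and that every
-- w ∈ 𝒟≥0(L) lies above a candidate.  Deleting the s-th entry of w gives a member of 𝒟≥0(L_s),
-- which lies above a minimal one, an output of A(L_s) by induction; reinserting 1 gives δ_s ≤ w.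
-- Hence max_s δ_s ≤ w, and the minimal solutions of steps (4) and (5) can be chosen below w.
-- For n = 2 everything is explicit: det(Diag(x, y) - L) = xy - ab.

open import Defs
open import Level using (0ℓ)
open import Data.Nat as ℕ using (ℕ; zero; suc; s≤s; z≤n; _≤_; _≤′_; ≤′-refl; ≤′-step)
import Data.Nat.Properties as ℕP
open import Data.Fin as Fin using (Fin; zero; suc; toℕ; punchIn; punchOut; _≟_)
import Data.Fin.Properties as FinP
open import Data.Vec using (Vec; []; _∷_; lookup; updateAt; insertAt; removeAt)
import Data.Vec.Properties as VecP
open import Data.Vec.Relation.Binary.Pointwise.Inductive as Pointwise using ([]; _∷_)
open import Data.Product using (Σ; ∃; _×_; _,_; proj₁; proj₂)
open import Function using (_∘_)
open import Function.Bundles using (_⇔_; mk⇔; Equivalence)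
open import Relation.Binary.PropositionalEquality
open import Relation.Nullary using (Dec; does; yes; no; contradiction)
open import Relation.Nullary.Decidable using (map′; _×-dec_; _→-dec_)
open import Relation.Unary using (Pred; Decidable; _⊆_)

≤ᵥ-refl : ∀ {n} {x : Vec ℕ n} → x ≤ᵥ x
≤ᵥ-refl = Pointwise.refl ℕP.≤-refl

≤ᵥ-trans : ∀ {n} {x y z : Vec ℕ n} → x ≤ᵥ y → y ≤ᵥ z → x ≤ᵥ z
≤ᵥ-trans = Pointwise.trans ℕP.≤-trans

≤ᵥ-antisym : ∀ {n} {x y : Vec ℕ n} → x ≤ᵥ y → y ≤ᵥ x → x ≡ y
≤ᵥ-antisym []       []       = refl
≤ᵥ-antisym (p ∷ ps) (q ∷ qs) = cong₂ _∷_ (ℕP.≤-antisym p q) (≤ᵥ-antisym ps qs)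

UpwardClosed : ∀ {n} → Pred (Vec ℕ n) 0ℓ → Set
UpwardClosed P = ∀ {x y} → x ≤ᵥ y → P x → P y

inc : ∀ {n} → Fin n → Vec ℕ n → Vec ℕ n
inc i x = updateAt x i suc

upwardClosed-inc : ∀ {n} {P : Pred (Vec ℕ n) 0ℓ} → (∀ i {x} → P x → P (inc i x)) → UpwardClosed P
upwardClosed-inc         P-inc []                          Px = Px
upwardClosed-inc {P = P} P-inc {a ∷ xs} {b ∷ ys} (a≤b ∷ xs≤ys) Px =
  raise-head (ℕP.≤⇒≤′ a≤b) (upwardClosed-inc (λ i → P-inc (suc i)) xs≤ys Px)
  where
  raise-head : ∀ {b} → a ≤′ b → P (a ∷ ys) → P (b ∷ ys)
  raise-head ≤′-refl       Pa = Pa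
  raise-head (≤′-step a≤b) Pa = P-inc zero (raise-head a≤b Pa)

least-below : {R : Pred ℕ 0ℓ} → Decidable R → (∀ {m k} → m ≤ k → R m → R k) →
  ∀ {a} → R a → ∃ λ m → m ≤ a × R m × (∀ {k} → R k → m ≤ k)
least-below R? up {zero}  Ra = zero , ℕP.≤-refl , Ra , λ _ → z≤n
least-below R? up {suc a} Ra with R? a
... | yes Ra′ with least-below R? up Ra′
...   | m , m≤a , Rm , least = m , ℕP.m≤n⇒m≤1+n m≤a , Rm , least
least-below R? up {suc a} Ra | no ¬Ra =
  suc a , ℕP.≤-refl , Ra , λ {k} Rk → ℕP.≰⇒> (λ k≤a → ¬Ra (up k≤a Rk))

-- Minimise the first coordinate, then the others; upward closure keeps the first one minimal.
min-below : ∀ {n} {P : Pred (Vec ℕ n) 0ℓ} → Decidable P → UpwardClosed P →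
  ∀ {x} → P x → ∃ λ y → y ≤ᵥ x × Min P y
min-below P? up {[]} Px = [] , [] , Px , λ { [] _ [] → refl }
min-below {P = P} P? up {a ∷ xs} Px
  with least-below (λ m → P? (m ∷ xs)) (λ m≤k → up (m≤k ∷ ≤ᵥ-refl)) Px
... | m , m≤a , Pm∷xs , m-least
  with min-below (λ ys → P? (m ∷ ys)) (λ ys≤zs → up (ℕP.≤-refl ∷ ys≤zs)) Pm∷xs
... | ys , ys≤xs , Pm∷ys , ys-minimal = m ∷ ys , m≤a ∷ ys≤xs , Pm∷ys , minimal
  where
  minimal : ∀ z → P z → z ≤ᵥ (m ∷ ys) → z ≡ m ∷ ys
  minimal (b ∷ zs) Pz (b≤m ∷ zs≤ys)
    with ℕP.≤-antisym b≤m (m-least (up (ℕP.≤-refl ∷ ≤ᵥ-trans zs≤ys ys≤xs) Pz))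
  ... | refl = cong (m ∷_) (ys-minimal zs Pz zs≤ys)

Min-coinitial : ∀ {n} {P Q : Pred (Vec ℕ n) 0ℓ} → P ⊆ Q → (∀ {w} → Q w → ∃ λ u → P u × u ≤ᵥ w) →
  ∀ v → Min P v ⇔ Min Q v
Min-coinitial {P = P} P⊆Q coinitial v = mk⇔
  (λ (Pv , v-minimal) → P⊆Q Pv , λ w Qw w≤v →
    let (u , Pu , u≤w) = coinitial Qw
    in ≤ᵥ-antisym w≤v (subst (_≤ᵥ w) (v-minimal u Pu (≤ᵥ-trans u≤w w≤v)) u≤w))
  (λ (Qv , v-minimal) →
    let (u , Pu , u≤v) = coinitial Qv
    in subst P (v-minimal u (P⊆Q Pu) u≤v) Pu , λ y Py y≤v → v-minimal y (P⊆Q Py) y≤v)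

lookup-removeAt : ∀ {A : Set} {n} (xs : Vec A (suc n)) i j → lookup (removeAt xs i) j ≡ lookup xs (punchIn i j)
lookup-removeAt (x ∷ xs)     zero    j       = refl
lookup-removeAt (x ∷ y ∷ xs) (suc i) zero    = refl
lookup-removeAt (x ∷ y ∷ xs) (suc i) (suc j) = lookup-removeAt (y ∷ xs) i j

module Determinants where

  open import Data.Bool using (if_then_else_)
  open import Data.Integer as ℤ using (ℤ; +_; 0ℤ; 1ℤ; _+_; _*_; -_; _-_; _<_; _<?_)
  import Data.Integer.Properties as ℤP
  open import Data.Integer.Tactic.RingSolver using (solve-∀)
  open import Data.Nat.Tactic.RingSolver using () renaming (solve-∀ to ℕ-solve-∀)
  import Data.Vec.Functional as Vector
  open import Relation.Binary.Definitions using (tri<; tri≈; tri>)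
  open import Algebra.Properties.Semiring.Sum ℤP.+-*-semiring
    using (sum; sum-cong-≗; ∑-distrib-+; sum-remove; *-distribˡ-sum; sum-replicate-zero)
  open ≡-Reasoning

  ∑≗sum : ∀ {n} (f : Fin n → ℤ) → ∑ f ≡ sum f
  ∑≗sum {zero}  f = refl
  ∑≗sum {suc n} f = cong (_+_ (f zero)) (∑≗sum (f ∘ suc))

  sgn-+ : ∀ a b → sgn (a ℕ.+ b) ≡ sgn a * sgn b
  sgn-+ zero          b = sym (ℤP.*-identityˡ (sgn b))
  sgn-+ (suc zero)    b = trans (sgn-suc b) (sym (ℤP.-1*i≡-i (sgn b)))
    where
    sgn-suc : ∀ a → sgn (suc a) ≡ - sgn a
    sgn-suc zero          = refl
    sgn-suc (suc zero)    = refl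
    sgn-suc (suc (suc a)) = sgn-suc a
  sgn-+ (suc (suc a)) b = sgn-+ a b

  sgn-double : ∀ a → sgn (a ℕ.+ a) ≡ 1ℤ
  sgn-double zero    = refl
  sgn-double (suc a) = trans (cong (sgn ∘ suc) (ℕP.+-suc a a)) (sgn-double a)

  minor : ∀ {n} → Fin (suc n) → Fin (suc n) → Matrix ℤ (suc n) → Matrix ℤ n
  minor r c M a b = M (punchIn r a) (punchIn c b)

  det-expand : ∀ {n} (M : Matrix ℤ (suc n)) →
    det M ≡ sum (λ j → sgn (toℕ j) * (M zero j * det (minor zero j M)))
  det-expand M = ∑≗sum (λ j → sgn (toℕ j) * (M zero j * det (minor zero j M)))

  det-cong : ∀ {n} {M N : Matrix ℤ n} → (∀ a b → M a b ≡ N a b) → det M ≡ det N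
  det-cong {zero}          M≗N = refl
  det-cong {suc n} {M} {N} M≗N = begin
    det M                                                    ≡⟨ det-expand M ⟩
    sum (λ j → sgn (toℕ j) * (M zero j * det (minor zero j M))) ≡⟨ sum-cong-≗ (λ j →
      cong₂ (λ x y → sgn (toℕ j) * (x * y)) (M≗N zero j) (det-cong (λ a b → M≗N (suc a) (punchIn j b)))) ⟩
    sum (λ j → sgn (toℕ j) * (N zero j * det (minor zero j N))) ≡⟨ det-expand N ⟨
    det N                                                    ∎

  -- Defined through does, so that 𝟙[ suc i ≡ suc j ] reduces to 𝟙[ i ≡ j ].
  𝟙[_≡_] : ∀ {n} → Fin n → Fin n → ℤ
  𝟙[ i ≡ j ] = if does (i ≟ j) then 1ℤ else 0ℤ

  𝟙-refl : ∀ {n} (i : Fin n) → 𝟙[ i ≡ i ] ≡ 1ℤ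
  𝟙-refl i with i ≟ i
  ... | yes _   = refl
  ... | no i≢i = contradiction refl i≢i

  𝟙-≢ : ∀ {n} {i j : Fin n} → i ≢ j → 𝟙[ i ≡ j ] ≡ 0ℤ
  𝟙-≢ {i = i} {j} i≢j with i ≟ j
  ... | yes i≡j = contradiction i≡j i≢j
  ... | no _    = refl

  𝟙-punchIn : ∀ {n} (c : Fin (suc n)) k → 𝟙[ c ≡ punchIn c k ] ≡ 0ℤ
  𝟙-punchIn c k = 𝟙-≢ (FinP.punchInᵢ≢i c k ∘ sym)

  𝟙-punchOut : ∀ {n} {j c : Fin (suc n)} (j≢c : j ≢ c) k → 𝟙[ c ≡ punchIn j k ] ≡ 𝟙[ punchOut j≢c ≡ k ]
  𝟙-punchOut {j = j} {c} j≢c k with punchOut j≢c ≟ k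
  ... | yes refl = trans (cong 𝟙[ c ≡_] (FinP.punchIn-punchOut j≢c)) (𝟙-refl c)
  ... | no ne    = 𝟙-≢ (λ c≡ → ne (FinP.punchIn-injective j _ _ (trans (FinP.punchIn-punchOut j≢c) c≡)))

  sum-𝟙 : ∀ {n} (c : Fin n) (f : Fin n → ℤ) → sum (λ j → 𝟙[ c ≡ j ] * f j) ≡ f c
  sum-𝟙 {suc n} c f = begin
    sum (λ j → 𝟙[ c ≡ j ] * f j)
      ≡⟨ sum-remove {i = c} (λ j → 𝟙[ c ≡ j ] * f j) ⟩
    𝟙[ c ≡ c ] * f c + sum (λ k → 𝟙[ c ≡ punchIn c k ] * f (punchIn c k))
      ≡⟨ cong₂ _+_ (cong (_* f c) (𝟙-refl c)) (sum-cong-≗ (λ k → cong (_* f (punchIn c k)) (𝟙-punchIn c k))) ⟩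
    1ℤ * f c + sum {n} (λ _ → 0ℤ)
      ≡⟨ cong₂ _+_ (ℤP.*-identityˡ (f c)) (sum-replicate-zero n) ⟩
    f c + 0ℤ
      ≡⟨ ℤP.+-identityʳ (f c) ⟩
    f c
      ∎

  -- Deleting column c and then column c₁ of the rest deletes the same pair of columns as deleting
  -- c₀ = punchIn c c₁ and then k₀ = punchOut (c₀ ≢ c); the two sign conventions differ by one swap.
  punchIn-swap : ∀ {n} (c : Fin (suc (suc n))) c₁ (ne : punchIn c c₁ ≢ c) b →
    punchIn (punchIn c c₁) (punchIn (punchOut ne) b) ≡ punchIn c (punchIn c₁ b)
  punchIn-swap zero    c₁      ne b = refl
  punchIn-swap (suc c) zero    ne b = refl
  punchIn-swap {suc n} (suc c) (suc c₁) ne zero    = refl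
  punchIn-swap {suc n} (suc c) (suc c₁) ne (suc b) = cong suc (punchIn-swap c c₁ (ne ∘ cong suc) b)

  sgn-punchIn-swap : ∀ {n} (c : Fin (suc (suc n))) c₁ (ne : punchIn c c₁ ≢ c) →
    sgn (suc (toℕ c ℕ.+ toℕ c₁)) ≡ sgn (toℕ (punchIn c c₁) ℕ.+ toℕ (punchOut ne))
  sgn-punchIn-swap zero    c₁      ne = cong sgn (sym (ℕP.+-identityʳ (suc (toℕ c₁))))
  sgn-punchIn-swap (suc c) zero    ne = cong (λ k → sgn (2 ℕ.+ k)) (ℕP.+-identityʳ (toℕ c))
  sgn-punchIn-swap {suc n} (suc c) (suc c₁) ne = begin
    sgn (suc (suc (toℕ c ℕ.+ suc (toℕ c₁))))
      ≡⟨ cong (λ k → sgn (2 ℕ.+ k)) (ℕP.+-suc (toℕ c) (toℕ c₁)) ⟩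
    sgn (suc (toℕ c ℕ.+ toℕ c₁))
      ≡⟨ sgn-punchIn-swap c c₁ ne′ ⟩
    sgn (toℕ (punchIn c c₁) ℕ.+ toℕ (punchOut ne′))
      ≡⟨ cong (λ k → sgn (1 ℕ.+ k)) (ℕP.+-suc (toℕ (punchIn c c₁)) (toℕ (punchOut ne′))) ⟨
    sgn (suc (toℕ (punchIn c c₁) ℕ.+ suc (toℕ (punchOut ne′))))
      ∎
    where ne′ = ne ∘ cong suc

  sgn-swap-cofactors : ∀ {n} r (c : Fin (suc (suc n))) c₁ (ne : punchIn c c₁ ≢ c) →
    sgn (toℕ (punchIn c c₁)) * sgn (r ℕ.+ toℕ (punchOut ne)) ≡ sgn (suc (r ℕ.+ toℕ c)) * sgn (toℕ c₁)
  sgn-swap-cofactors r c c₁ ne = begin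
    sgn c₀ * sgn (r ℕ.+ k₀)             ≡⟨ sgn-+ c₀ (r ℕ.+ k₀) ⟨
    sgn (c₀ ℕ.+ (r ℕ.+ k₀))             ≡⟨ cong sgn (+-left-swap c₀ r k₀) ⟩
    sgn (r ℕ.+ (c₀ ℕ.+ k₀))             ≡⟨ sgn-+ r (c₀ ℕ.+ k₀) ⟩
    sgn r * sgn (c₀ ℕ.+ k₀)             ≡⟨ cong (sgn r *_) (sgn-punchIn-swap c c₁ ne) ⟨
    sgn r * sgn (suc (toℕ c ℕ.+ toℕ c₁)) ≡⟨ sgn-+ r (suc (toℕ c ℕ.+ toℕ c₁)) ⟨
    sgn (r ℕ.+ suc (toℕ c ℕ.+ toℕ c₁))   ≡⟨ cong sgn (ℕP.+-suc r (toℕ c ℕ.+ toℕ c₁)) ⟩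
    sgn (suc (r ℕ.+ (toℕ c ℕ.+ toℕ c₁))) ≡⟨ cong (sgn ∘ ℕ.suc) (ℕP.+-assoc r (toℕ c) (toℕ c₁)) ⟨
    sgn (suc (r ℕ.+ toℕ c) ℕ.+ toℕ c₁)   ≡⟨ sgn-+ (suc (r ℕ.+ toℕ c)) (toℕ c₁) ⟩
    sgn (suc (r ℕ.+ toℕ c)) * sgn (toℕ c₁) ∎
    where
    c₀ = toℕ (punchIn c c₁)
    k₀ = toℕ (punchOut ne)
    +-left-swap : ∀ x y z → x ℕ.+ (y ℕ.+ z) ≡ y ℕ.+ (x ℕ.+ z)
    +-left-swap = ℕ-solve-∀

  addUnit : ∀ {n} → Fin n → Fin n → Matrix ℤ n → Matrix ℤ n
  addUnit r c M a b = M a b + 𝟙[ r ≡ a ] * 𝟙[ c ≡ b ]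

  det-addUnit-row₀ : ∀ {n} (M : Matrix ℤ (suc n)) c →
    det (addUnit zero c M) ≡ det M + sgn (toℕ c) * det (minor zero c M)
  det-addUnit-row₀ M c = begin
    det (addUnit zero c M)
      ≡⟨ det-expand (addUnit zero c M) ⟩
    sum (λ j → sgn (toℕ j) * ((M zero j + 1ℤ * 𝟙[ c ≡ j ]) * det (minor zero j (addUnit zero c M))))
      ≡⟨ sum-cong-≗ (λ j → trans (cong (λ x → sgn (toℕ j) * ((M zero j + 1ℤ * 𝟙[ c ≡ j ]) * x)) (lower-rows j))
                                  (expand-row (sgn (toℕ j)) (M zero j) 𝟙[ c ≡ j ] (det (minor zero j M)))) ⟩
    sum (λ j → t j + 𝟙[ c ≡ j ] * (sgn (toℕ j) * det (minor zero j M)))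
      ≡⟨ ∑-distrib-+ t (λ j → 𝟙[ c ≡ j ] * (sgn (toℕ j) * det (minor zero j M))) ⟩
    sum t + sum (λ j → 𝟙[ c ≡ j ] * (sgn (toℕ j) * det (minor zero j M)))
      ≡⟨ cong₂ _+_ (sym (det-expand M)) (sum-𝟙 c (λ j → sgn (toℕ j) * det (minor zero j M))) ⟩
    det M + sgn (toℕ c) * det (minor zero c M)
      ∎
    where
    t : Fin _ → ℤ
    t j = sgn (toℕ j) * (M zero j * det (minor zero j M))
    lower-rows : ∀ j → det (minor zero j (addUnit zero c M)) ≡ det (minor zero j M)
    lower-rows j = det-cong {N = minor zero j M} (λ a b → ℤP.+-identityʳ _)
    expand-row : ∀ s m d D → s * ((m + 1ℤ * d) * D) ≡ s * (m * D) + d * (s * D)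
    expand-row = solve-∀

  minor₀-addUnit-self : ∀ {n} (M : Matrix ℤ (suc (suc n))) r c a b →
    minor zero c (addUnit (suc r) c M) a b ≡ minor zero c M a b
  minor₀-addUnit-self M r c a b =
    trans (cong (λ x → M (suc a) (punchIn c b) + 𝟙[ r ≡ a ] * x) (𝟙-punchIn c b)) (x+y*0≡x _ 𝟙[ r ≡ a ])
    where
    x+y*0≡x : ∀ x y → x + y * 0ℤ ≡ x
    x+y*0≡x = solve-∀

  minor₀-addUnit-other : ∀ {n} (M : Matrix ℤ (suc (suc n))) r {c j} (j≢c : j ≢ c) a b →
    minor zero j (addUnit (suc r) c M) a b ≡ addUnit r (punchOut j≢c) (minor zero j M) a b
  minor₀-addUnit-other M r j≢c a b = cong (λ x → M (suc a) (punchIn _ b) + 𝟙[ r ≡ a ] * x) (𝟙-punchOut j≢c b)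

  det-addUnit : ∀ {n} (M : Matrix ℤ (suc n)) r c →
    det (addUnit r c M) ≡ det M + sgn (toℕ r ℕ.+ toℕ c) * det (minor r c M)
  det-addUnit M zero c = det-addUnit-row₀ M c
  det-addUnit {suc n} M (suc r) c = begin
    det M′
      ≡⟨ det-expand M′ ⟩
    sum t′
      ≡⟨ sum-remove {i = c} t′ ⟩
    t′ c + sum (t′ ∘ punchIn c)
      ≡⟨ cong₂ _+_ column-c (sum-cong-≗ other-columns) ⟩
    t c + sum (λ c₁ → t (punchIn c c₁) + s * u c₁)
      ≡⟨ cong (_+_ (t c)) (∑-distrib-+ (t ∘ punchIn c) (λ c₁ → s * u c₁)) ⟩
    t c + (sum (t ∘ punchIn c) + sum (λ c₁ → s * u c₁))
      ≡⟨ ℤP.+-assoc (t c) (sum (t ∘ punchIn c)) _ ⟨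
    t c + sum (t ∘ punchIn c) + sum (λ c₁ → s * u c₁)
      ≡⟨ cong₂ _+_ (sum-remove {i = c} t) (*-distribˡ-sum s u) ⟨
    sum t + s * sum u
      ≡⟨ cong₂ (λ x y → x + s * y) (det-expand M) (det-expand (minor (suc r) c M)) ⟨
    det M + s * det (minor (suc r) c M)
      ∎
    where
    M′ = addUnit (suc r) c M
    s = sgn (suc (toℕ r ℕ.+ toℕ c))
    t t′ : Fin (suc (suc n)) → ℤ
    t  j = sgn (toℕ j) * (M zero j * det (minor zero j M))
    t′ j = sgn (toℕ j) * (M′ zero j * det (minor zero j M′))
    u : Fin (suc n) → ℤ
    u c₁ = sgn (toℕ c₁) * (M zero (punchIn c c₁) * det (minor zero c₁ (minor (suc r) c M)))

    column-c : t′ c ≡ t c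
    column-c = cong₂ (λ x y → sgn (toℕ c) * (x * y)) (ℤP.+-identityʳ (M zero c))
                     (det-cong (minor₀-addUnit-self M r c))

    other-columns : ∀ c₁ → t′ (punchIn c c₁) ≡ t (punchIn c c₁) + s * u c₁
    other-columns c₁ = begin
      t′ c₀
        ≡⟨ cong₂ (λ x y → sgn (toℕ c₀) * (x * y)) (ℤP.+-identityʳ (M zero c₀))
                 (det-cong (minor₀-addUnit-other M r c₀≢c)) ⟩
      sgn (toℕ c₀) * (M zero c₀ * det (addUnit r k₀ N))
        ≡⟨ cong (λ x → sgn (toℕ c₀) * (M zero c₀ * x)) (det-addUnit N r k₀) ⟩
      sgn (toℕ c₀) * (M zero c₀ * (det N + sgn (toℕ r ℕ.+ toℕ k₀) * det (minor r k₀ N)))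
        ≡⟨ distribute (sgn (toℕ c₀)) (M zero c₀) (det N) (sgn (toℕ r ℕ.+ toℕ k₀)) (det (minor r k₀ N)) ⟩
      t c₀ + sgn (toℕ c₀) * sgn (toℕ r ℕ.+ toℕ k₀) * (M zero c₀ * det (minor r k₀ N))
        ≡⟨ cong₂ (λ x y → t c₀ + x * (M zero c₀ * y)) (sgn-swap-cofactors (toℕ r) c c₁ c₀≢c)
                 (det-cong (λ a b → cong (M (suc (punchIn r a))) (punchIn-swap c c₁ c₀≢c b))) ⟩
      t c₀ + s * sgn (toℕ c₁) * (M zero c₀ * det (minor zero c₁ (minor (suc r) c M)))
        ≡⟨ cong (_+_ (t c₀)) (ℤP.*-assoc s (sgn (toℕ c₁)) _) ⟩
      t c₀ + s * u c₁
        ∎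
      where
      c₀ = punchIn c c₁
      c₀≢c = FinP.punchInᵢ≢i c c₁
      k₀ = punchOut c₀≢c
      N = minor zero c₀ M
      distribute : ∀ σ m d τ e → σ * (m * (d + τ * e)) ≡ σ * (m * d) + σ * τ * (m * e)
      distribute = solve-∀

  det-addUnit-diag : ∀ {n} (M : Matrix ℤ (suc n)) i → det (addUnit i i M) ≡ det M + det (minor i i M)
  det-addUnit-diag M i = begin
    det (addUnit i i M)
      ≡⟨ det-addUnit M i i ⟩
    det M + sgn (toℕ i ℕ.+ toℕ i) * det (minor i i M)
      ≡⟨ cong (λ x → det M + x * det (minor i i M)) (sgn-double (toℕ i)) ⟩
    det M + 1ℤ * det (minor i i M)
      ≡⟨ cong (_+_ (det M)) (ℤP.*-identityˡ (det (minor i i M))) ⟩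
    det M + det (minor i i M)
      ∎

  punchIn-strictlyIncreasing : ∀ {n} (i : Fin (suc n)) → StrictlyIncreasing (punchIn i)
  punchIn-strictlyIncreasing zero    a       b       a<b       = s≤s a<b
  punchIn-strictlyIncreasing (suc i) zero    (suc b) a<b       = s≤s z≤n
  punchIn-strictlyIncreasing (suc i) (suc a) (suc b) (s≤s a<b) = s≤s (punchIn-strictlyIncreasing i a b a<b)

  strictlyIncreasing-∘ : ∀ {k m n} {σ : Fin m → Fin n} {τ : Fin k → Fin m} →
    StrictlyIncreasing σ → StrictlyIncreasing τ → StrictlyIncreasing (σ ∘ τ)
  strictlyIncreasing-∘ σ↑ τ↑ a b a<b = σ↑ _ _ (τ↑ a b a<b)

  strictlyIncreasing⇒injective : ∀ {k n} {σ : Fin k → Fin n} → StrictlyIncreasing σ → ∀ {a b} → σ a ≡ σ b → a ≡ b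
  strictlyIncreasing⇒injective {σ = σ} σ↑ {a} {b} σa≡σb with FinP.<-cmp a b
  ... | tri< a<b _ _ = contradiction (cong toℕ σa≡σb) (ℕP.<⇒≢ (σ↑ a b a<b))
  ... | tri≈ _ a≡b _ = a≡b
  ... | tri> _ _ b<a = contradiction (cong toℕ (sym σa≡σb)) (ℕP.<⇒≢ (σ↑ b a b<a))

  𝟙-image : ∀ {k n} {σ : Fin k → Fin n} → StrictlyIncreasing σ → ∀ {i j} → σ j ≡ i → ∀ a → 𝟙[ i ≡ σ a ] ≡ 𝟙[ j ≡ a ]
  𝟙-image σ↑ {i} {j} σj≡i a with j ≟ a
  ... | yes refl = trans (cong 𝟙[ i ≡_] σj≡i) (𝟙-refl i)
  ... | no j≢a   = 𝟙-≢ (λ i≡σa → j≢a (strictlyIncreasing⇒injective σ↑ (trans σj≡i i≡σa)))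

  det-principalSub-addUnit-hit : ∀ {k n} (M : Matrix ℤ n) {σ : Fin (suc k) → Fin n} → StrictlyIncreasing σ →
    ∀ {i j} → σ j ≡ i →
    det (principalSub σ (addUnit i i M)) ≡ det (principalSub σ M) + det (principalSub (σ ∘ punchIn j) M)
  det-principalSub-addUnit-hit M {σ} σ↑ {i} {j} σj≡i = begin
    det (principalSub σ (addUnit i i M))
      ≡⟨ det-cong (λ a b → cong₂ (λ x y → M (σ a) (σ b) + x * y) (𝟙-image σ↑ σj≡i a) (𝟙-image σ↑ σj≡i b)) ⟩
    det (addUnit j j (principalSub σ M))
      ≡⟨ det-addUnit-diag (principalSub σ M) j ⟩
    det (principalSub σ M) + det (principalSub (σ ∘ punchIn j) M)
      ∎

  det-principalSub-addUnit-miss : ∀ {k n} (M : Matrix ℤ n) {σ : Fin k → Fin n} {i} → (∀ j → σ j ≢ i) →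
    det (principalSub σ (addUnit i i M)) ≡ det (principalSub σ M)
  det-principalSub-addUnit-miss M {σ} i∉σ = det-cong (λ a b →
    trans (cong (λ x → M (σ a) (σ b) + x * _) (𝟙-≢ (i∉σ a ∘ sym))) (ℤP.+-identityʳ _))

  properMinorsPositive-addUnit : ∀ {n} (M : Matrix ℤ n) i →
    ProperMinorsPositive M → ProperMinorsPositive (addUnit i i M)
  properMinorsPositive-addUnit M i minors>0 k k<n σ σ↑ with FinP.any? (λ j → σ j ≟ i)
  ... | no i∉σ = subst (0ℤ <_) (sym (det-principalSub-addUnit-miss M (λ j σj≡i → i∉σ (j , σj≡i))))
                   (minors>0 k k<n σ σ↑)
  properMinorsPositive-addUnit M i minors>0 (suc k) k<n σ σ↑ | yes (j , σj≡i) =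
    subst (0ℤ <_) (sym (det-principalSub-addUnit-hit M σ↑ σj≡i))
      (ℤP.+-mono-< (minors>0 (suc k) k<n σ σ↑)
                   (minors>0 k (ℕP.<-trans (ℕP.n<1+n k) k<n) (σ ∘ punchIn j)
                     (strictlyIncreasing-∘ σ↑ (punchIn-strictlyIncreasing j))))

  all-maps? : ∀ {k n} {Q : (Fin k → Fin n) → Set} → (∀ {σ τ} → σ ≗ τ → Q σ → Q τ) →
    (∀ σ → Dec (Q σ)) → Dec (∀ σ → Q σ)
  all-maps? {zero}  resp Q? = map′ (λ q σ → resp (λ ()) q) (λ ∀Q → ∀Q empty) (Q? empty)
    where
    empty : Fin zero → Fin _
    empty ()
  all-maps? {suc k} resp Q? = map′
    (λ ∀Q σ → resp (λ { zero → refl ; (suc a) → refl }) (∀Q (σ zero) (σ ∘ suc)))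
    (λ ∀Q a τ → ∀Q (a Vector.∷ τ))
    (FinP.all? (λ a → all-maps? (λ τ≗τ′ → resp (λ { zero → refl ; (suc b) → τ≗τ′ b })) (λ τ → Q? (a Vector.∷ τ))))

  properMinorsPositive? : ∀ {n} (M : Matrix ℤ n) → Dec (ProperMinorsPositive M)
  properMinorsPositive? {n} M = map′ (λ ∀k k k<n → ∀k {k} k<n) (λ ∀k {k} k<n → ∀k k k<n)
    (ℕP.allUpTo? (λ k → all-maps? respects (λ σ → strictlyIncreasing? σ →-dec (0ℤ <? det (principalSub σ M)))) n)
    where
    respects : ∀ {k} {σ τ : Fin k → Fin n} → σ ≗ τ →
      (StrictlyIncreasing σ → 0ℤ < det (principalSub σ M)) → StrictlyIncreasing τ → 0ℤ < det (principalSub τ M)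
    respects σ≗τ minor>0 τ↑ =
      subst (0ℤ <_) (det-cong (λ a b → cong₂ M (σ≗τ a) (σ≗τ b)))
        (minor>0 (λ a b a<b → subst₂ Fin._<_ (sym (σ≗τ a)) (sym (σ≗τ b)) (τ↑ a b a<b)))
    strictlyIncreasing? : ∀ {k} (σ : Fin k → Fin n) → Dec (StrictlyIncreasing σ)
    strictlyIncreasing? σ = FinP.all? (λ a → FinP.all? (λ b → (a FinP.<? b) →-dec (σ a FinP.<? σ b)))

  𝟙*𝟙-≢ : ∀ {n} (i : Fin n) {a b} → a ≢ b → 𝟙[ i ≡ a ] * 𝟙[ i ≡ b ] ≡ 0ℤ
  𝟙*𝟙-≢ i {a} a≢b with i ≟ a
  ... | yes refl = trans (ℤP.*-identityˡ _) (𝟙-≢ a≢b)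
  ... | no _     = refl

  DiagMinus-inc : ∀ {n} (L : Matrix ℕ n) x i a b → DiagMinus (inc i x) L a b ≡ addUnit i i (DiagMinus x L) a b
  DiagMinus-inc L x i a b with a ≟ b
  DiagMinus-inc L x i a b | no a≢b = sym (trans (cong (λ z → - (+ L a b) + z) (𝟙*𝟙-≢ i a≢b)) (ℤP.+-identityʳ _))
  DiagMinus-inc L x i a b | yes refl with i ≟ a
  ... | yes refl = trans (cong (λ m → + m - + L a a) (VecP.lookup∘updateAt a x)) (shift (+ lookup x a) (+ L a a))
    where
    -- + suc m is 1ℤ + + m by definition.
    shift : ∀ m l → 1ℤ + m - l ≡ m - l + 1ℤ * 1ℤ
    shift = solve-∀
  ... | no i≢a = trans (cong (λ m → + m - + L a a) (VecP.lookup∘updateAt′ a i (i≢a ∘ sym) x)) (sym (ℤP.+-identityʳ _))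

  properMinorsPositive-cong : ∀ {n} {M N : Matrix ℤ n} → (∀ a b → M a b ≡ N a b) →
    ProperMinorsPositive M → ProperMinorsPositive N
  properMinorsPositive-cong M≗N minors>0 k k<n σ σ↑ =
    subst (0ℤ <_) (det-cong (λ a b → M≗N (σ a) (σ b))) (minors>0 k k<n σ σ↑)

  properMinorsPositive-inc : ∀ {n} (L : Matrix ℕ n) x i → ProperMinorsPositive (DiagMinus x L) →
    ProperMinorsPositive (DiagMinus (inc i x) L)
  properMinorsPositive-inc L x i minors>0 =
    properMinorsPositive-cong (λ a b → sym (DiagMinus-inc L x i a b))
      (properMinorsPositive-addUnit (DiagMinus x L) i minors>0)

  properMinorsPositive-principalSub : ∀ {n} (M : Matrix ℤ (suc n)) → ProperMinorsPositive M →
    ∀ s → ProperMinorsPositive (principalSub (punchIn s) M)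
  properMinorsPositive-principalSub M minors>0 s k k<n σ σ↑ =
    minors>0 k (ℕP.m≤n⇒m≤1+n k<n) (punchIn s ∘ σ) (strictlyIncreasing-∘ (punchIn-strictlyIncreasing s) σ↑)

  det-principalSub-punchIn>0 : ∀ {n} (M : Matrix ℤ (suc n)) → ProperMinorsPositive M →
    ∀ s → 0ℤ < det (principalSub (punchIn s) M)
  det-principalSub-punchIn>0 M minors>0 s = minors>0 _ ℕP.≤-refl (punchIn s) (punchIn-strictlyIncreasing s)

  det-DiagMinus-inc≥0 : ∀ {n} (L : Matrix ℕ n) x i → ProperMinorsPositive (DiagMinus x L) →
    0ℤ ℤ.≤ det (DiagMinus x L) → 0ℤ ℤ.≤ det (DiagMinus (inc i x) L)
  det-DiagMinus-inc≥0 {suc n} L x i minors>0 det≥0 =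
    subst (0ℤ ℤ.≤_) (sym (trans (det-cong (DiagMinus-inc L x i)) (det-addUnit-diag (DiagMinus x L) i)))
      (ℤP.+-mono-≤ det≥0 (ℤP.<⇒≤ (det-principalSub-punchIn>0 (DiagMinus x L) minors>0 i)))

  DiagMinus-isZMatrix : ∀ {n} (d : Vec ℕ n) (L : Matrix ℕ n) → IsZMatrix (DiagMinus d L)
  DiagMinus-isZMatrix d L i j i≢j with i ≟ j
  ... | yes i≡j = contradiction i≡j i≢j
  ... | no _    = ℤP.neg-mono-≤ (ℤ.+≤+ z≤n)

  DiagMinus-removeAt : ∀ {n} (w : Vec ℕ (suc n)) (L : Matrix ℕ (suc n)) s a b →
    DiagMinus (removeAt w s) (delRC s L) a b ≡ principalSub (punchIn s) (DiagMinus w L) a b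
  DiagMinus-removeAt w L s a b with a ≟ b | punchIn s a ≟ punchIn s b
  ... | yes refl | yes _   = cong (λ m → + m - + L (punchIn s a) (punchIn s a)) (lookup-removeAt w s a)
  ... | yes refl | no sa≢sa = contradiction refl sa≢sa
  ... | no a≢b   | yes sa≡sb = contradiction (FinP.punchIn-injective s a b sa≡sb) a≢b
  ... | no _     | no _    = refl

  det₂ : (M : Matrix ℤ 2) → det M ≡ M zero zero * M (suc zero) (suc zero) - M zero (suc zero) * M (suc zero) zero
  det₂ M = expand (M zero zero) (M zero (suc zero)) (M (suc zero) zero) (M (suc zero) (suc zero))
    where
    -- The left-hand side is det M unfolded.
    expand : ∀ p q r s →
      1ℤ * (p * (1ℤ * (s * 1ℤ) + 0ℤ)) + (- 1ℤ * (q * (1ℤ * (r * 1ℤ) + 0ℤ)) + 0ℤ)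
        ≡ p * s - q * r
    expand = solve-∀

  det₁ : (M : Matrix ℤ 1) → det M ≡ M zero zero
  det₁ M = expand (M zero zero)
    where
    expand : ∀ p → 1ℤ * (p * 1ℤ) + 0ℤ ≡ p
    expand = solve-∀

  properMinorsPositive₂ : (M : Matrix ℤ 2) → (∀ i → 0ℤ < M i i) → ProperMinorsPositive M
  properMinorsPositive₂ M diag>0 zero       _                 σ _ = ℤ.+<+ (s≤s z≤n)
  properMinorsPositive₂ M diag>0 (suc zero) _                 σ _ =
    subst (0ℤ <_) (sym (det₁ (principalSub σ M))) (diag>0 (σ zero))
  properMinorsPositive₂ M diag>0 (suc (suc k)) (s≤s (s≤s ())) σ _

  DiagMinus-diag : ∀ {n} (d : Vec ℕ n) (L : Matrix ℕ n) i → DiagMinus d L i i ≡ + lookup d i - + L i i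
  DiagMinus-diag d L i with i ≟ i
  ... | yes _   = refl
  ... | no i≢i = contradiction refl i≢i

open Determinants

open import Data.Nat using (_⊔_; _*_; _+_)
open import Data.Nat.DivMod using (_/_; _%_; m≡m%n+[m/n]*n; m%n<n; m<n*o⇒m/o<n)
open import Data.Integer as ℤ using (+_; 0ℤ; -_; _-_)
import Data.Integer.Properties as ℤP
open import Data.Integer.Tactic.RingSolver using (solve-∀)

positive-upwardClosed : ∀ {n} → UpwardClosed {n} Positive
positive-upwardClosed x≤y x>0 i = ℕP.≤-trans (x>0 i) (Pointwise.lookup x≤y i)

positive? : ∀ {n} → Decidable {A = Vec ℕ n} Positive
positive? d = FinP.all? (λ i → 1 ℕP.≤? lookup d i)

module _ {n} (L : Matrix ℕ n) where

  properMinorsPositive-upwardClosed : UpwardClosed (λ x → ProperMinorsPositive (DiagMinus x L))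
  properMinorsPositive-upwardClosed = upwardClosed-inc λ i {x} → properMinorsPositive-inc L x i

  isAlmostNonsingularM-upwardClosed : UpwardClosed (λ x → IsAlmostNonsingularM (DiagMinus x L))
  isAlmostNonsingularM-upwardClosed = upwardClosed-inc λ i {x} (_ , minors>0 , det≥0) →
    DiagMinus-isZMatrix (inc i x) L , properMinorsPositive-inc L x i minors>0 ,
    det-DiagMinus-inc≥0 L x i minors>0 det≥0

  D≥0-upwardClosed : UpwardClosed (D≥0 L)
  D≥0-upwardClosed x≤y (x>0 , x-almostM) =
    positive-upwardClosed x≤y x>0 , isAlmostNonsingularM-upwardClosed x≤y x-almostM

  D≥0? : Decidable (D≥0 L)
  D≥0? d = map′ (λ (d>0 , minors>0 , det≥0) → d>0 , DiagMinus-isZMatrix d L , minors>0 , det≥0)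
                (λ (d>0 , _ , minors>0 , det≥0) → d>0 , minors>0 , det≥0)
                (positive? d ×-dec properMinorsPositive? (DiagMinus d L) ×-dec (0ℤ ℤP.≤? det (DiagMinus d L)))

D≥0-removeAt : ∀ {n} (L : Matrix ℕ (suc n)) s {w} → D≥0 L w → D≥0 (delRC s L) (removeAt w s)
D≥0-removeAt L s {w} (w>0 , _ , minors>0 , det≥0) =
  (λ j → subst (1 ℕ.≤_) (sym (lookup-removeAt w s j)) (w>0 (punchIn s j))) ,
  DiagMinus-isZMatrix (removeAt w s) (delRC s L) ,
  properMinorsPositive-cong (λ a b → sym (DiagMinus-removeAt w L s a b))
    (properMinorsPositive-principalSub (DiagMinus w L) minors>0 s) ,
  ℤP.<⇒≤ (subst (0ℤ ℤ.<_) (sym (det-cong (DiagMinus-removeAt w L s)))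
            (det-principalSub-punchIn>0 (DiagMinus w L) minors>0 s))

m≤[m+k]/[1+k]*[1+k] : ∀ m k → m ≤ ((m + k) / suc k) * suc k
m≤[m+k]/[1+k]*[1+k] m k = ℕP.+-cancelʳ-≤ k m _ (begin
  m + k                       ≡⟨ m≡m%n+[m/n]*n (m + k) (suc k) ⟩
  (m + k) % suc k + q * suc k ≤⟨ ℕP.+-monoˡ-≤ (q * suc k) (ℕP.<⇒≤pred (m%n<n (m + k) (suc k))) ⟩
  k + q * suc k               ≡⟨ ℕP.+-comm k (q * suc k) ⟩
  q * suc k + k               ∎)
  where
  open ℕP.≤-Reasoning
  q = (m + k) / suc k

m≤[1+k]*n⇒[m+k]/[1+k]≤n : ∀ m k n → m ≤ suc k * n → (m + k) / suc k ≤ n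
m≤[1+k]*n⇒[m+k]/[1+k]≤n m k n m≤ = ℕP.<⇒≤pred (m<n*o⇒m/o<n (begin-strict
  m + k                 ≤⟨ ℕP.+-monoˡ-≤ k m≤ ⟩
  suc k * n + k         <⟨ ℕP.+-monoʳ-< (suc k * n) (ℕP.n<1+n k) ⟩
  suc k * n + suc k     ≡⟨ cong (_+ suc k) (ℕP.*-comm (suc k) n) ⟩
  n * suc k + suc k     ≡⟨ ℕP.+-comm (n * suc k) (suc k) ⟩
  suc n * suc k         ∎))
  where open ℕP.≤-Reasoning

module Base (L : Matrix ℕ 2) (diag≡0 : ∀ i → L i i ≡ 0) where

  a b : ℕ
  a = L zero (suc zero)
  b = L (suc zero) zero

  -- procA 0 L is Min Candidate by definition, and likewise procA (suc n) L is Min Step.Candidate.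
  Candidate : Pred (Vec ℕ 2) 0ℓ
  Candidate v = ∃ λ k → suc k ≤ (1 ⊔ (a * b)) × v ≡ suc k ∷ (1 ⊔ ((a * b + k) / suc k)) ∷ []

  det≥0⇔ : ∀ x y → 0ℤ ℤ.≤ det (DiagMinus (x ∷ y ∷ []) L) ⇔ a * b ≤ x * y
  det≥0⇔ x y = mk⇔ (λ det≥0 → ℤP.drop‿+≤+ (ℤP.0≤i-j⇒j≤i (subst (0ℤ ℤ.≤_) det≡ det≥0)))
                   (λ ab≤xy → subst (0ℤ ℤ.≤_) (sym det≡) (ℤP.i≤j⇒0≤j-i (ℤ.+≤+ ab≤xy)))
    where
    det≡ : det (DiagMinus (x ∷ y ∷ []) L) ≡ + (x * y) - + (a * b)
    det≡ = begin
      det (DiagMinus (x ∷ y ∷ []) L)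
        ≡⟨ det₂ (DiagMinus (x ∷ y ∷ []) L) ⟩
      (+ x - + L zero zero) ℤ.* (+ y - + L (suc zero) (suc zero)) - (- + a) ℤ.* (- + b)
        ≡⟨ cong₂ (λ p q → (+ x - + p) ℤ.* (+ y - + q) - (- + a) ℤ.* (- + b)) (diag≡0 zero) (diag≡0 (suc zero)) ⟩
      (+ x - 0ℤ) ℤ.* (+ y - 0ℤ) - (- + a) ℤ.* (- + b)
        ≡⟨ simplify (+ x) (+ y) (+ a) (+ b) ⟩
      + x ℤ.* + y - + a ℤ.* + b
        ≡⟨ cong₂ _-_ (ℤP.pos-* x y) (ℤP.pos-* a b) ⟨
      + (x * y) - + (a * b)
        ∎
      where
      open ≡-Reasoning
      simplify : ∀ x y a b → (x - 0ℤ) ℤ.* (y - 0ℤ) - (- a) ℤ.* (- b) ≡ x ℤ.* y - a ℤ.* b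
      simplify = solve-∀

  positive⇒properMinorsPositive : ∀ {v} → Positive v → ProperMinorsPositive (DiagMinus v L)
  positive⇒properMinorsPositive {v} v>0 = properMinorsPositive₂ (DiagMinus v L) λ i →
    subst (0ℤ ℤ.<_) (sym (trans (DiagMinus-diag v L i) (cong (λ l → + lookup v i - + l) (diag≡0 i))))
      (subst (0ℤ ℤ.<_) (sym (ℤP.+-identityʳ (+ lookup v i))) (ℤ.+<+ (v>0 i)))

  candidate⇒D≥0 : ∀ {v} → Candidate v → D≥0 L v
  candidate⇒D≥0 (k , _ , refl) = v>0 , DiagMinus-isZMatrix _ L , positive⇒properMinorsPositive v>0 ,
    Equivalence.from (det≥0⇔ (suc k) y) (begin
      a * b          ≤⟨ m≤[m+k]/[1+k]*[1+k] (a * b) k ⟩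
      q * suc k      ≡⟨ ℕP.*-comm q (suc k) ⟩
      suc k * q      ≤⟨ ℕP.*-monoʳ-≤ (suc k) (ℕP.m≤n⊔m 1 q) ⟩
      suc k * y      ∎)
    where
    open ℕP.≤-Reasoning
    q = (a * b + k) / suc k
    y = 1 ⊔ q
    v>0 : Positive (suc k ∷ y ∷ [])
    v>0 zero       = s≤s z≤n
    v>0 (suc zero) = ℕP.m≤m⊔n 1 q

  1⊔n≡1+ : ∀ n → ∃ λ k → 1 ⊔ n ≡ suc k
  1⊔n≡1+ zero    = 0 , refl
  1⊔n≡1+ (suc n) = n , refl

  candidate-below : ∀ {w} → D≥0 L w → ∃ λ u → Candidate u × u ≤ᵥ w
  candidate-below {zero ∷ y ∷ []} (w>0 , _) = contradiction (w>0 zero) λ ()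
  candidate-below {suc k ∷ y ∷ []} (w>0 , _ , _ , det≥0) with suc k ℕP.≤? 1 ⊔ (a * b)
  ... | yes x≤1⊔ab = _ , (k , x≤1⊔ab , refl) ,
    ℕP.≤-refl ∷ ℕP.⊔-lub (w>0 (suc zero)) (m≤[1+k]*n⇒[m+k]/[1+k]≤n (a * b) k y ab≤xy) ∷ []
    where ab≤xy = Equivalence.to (det≥0⇔ (suc k) y) det≥0
  ... | no x≰1⊔ab with 1⊔n≡1+ (a * b)
  ...   | k′ , 1⊔ab≡ = _ , (k′ , ℕP.≤-reflexive (sym 1⊔ab≡) , refl) ,
    ℕP.<⇒≤ (subst (ℕ._< suc k) 1⊔ab≡ (ℕP.≰⇒> x≰1⊔ab)) ∷
    ℕP.⊔-lub (w>0 (suc zero)) (ℕP.≤-trans (m≤[1+k]*n⇒[m+k]/[1+k]≤n (a * b) k′ 1 ab≤) (w>0 (suc zero))) ∷ []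
    where
    ab≤ : a * b ≤ suc k′ * 1
    ab≤ = subst (a * b ≤_) (trans 1⊔ab≡ (sym (ℕP.*-identityʳ (suc k′)))) (ℕP.m≤n⊔m 1 (a * b))

  procA-base : ∀ v → procA 0 L v ⇔ Min (D≥0 L) v
  procA-base = Min-coinitial candidate⇒D≥0 candidate-below

maxFin-lub : ∀ {n} (f : Fin n → ℕ) {c} → (∀ s → f s ≤ c) → maxFin f ≤ c
maxFin-lub {zero}  f f≤c = z≤n
maxFin-lub {suc n} f f≤c = ℕP.⊔-lub (f≤c zero) (maxFin-lub (f ∘ suc) (f≤c ∘ suc))

cmax-lub : ∀ {m n} (δ : Fin m → Vec ℕ n) {w} → (∀ s → δ s ≤ᵥ w) → cmax δ ≤ᵥ w
cmax-lub δ {w} δ≤w = subst (cmax δ ≤ᵥ_) (VecP.tabulate∘lookup w)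
  (Pointwise.tabulate⁺ (λ i → maxFin-lub (λ s → lookup (δ s) i) (λ s → Pointwise.lookup (δ≤w s) i)))

insertAt-≤ᵥ : ∀ {n} {d : Vec ℕ n} {w} s → d ≤ᵥ removeAt w s → Positive w → insertAt d s 1 ≤ᵥ w
insertAt-≤ᵥ {w = _ ∷ _}     zero    d≤w            w>0 = w>0 zero ∷ d≤w
insertAt-≤ᵥ {d = _ ∷ _} {w = _ ∷ _ ∷ _} (suc s) (x≤y ∷ d≤w) w>0 = x≤y ∷ insertAt-≤ᵥ s d≤w (w>0 ∘ suc)

Eset-below : ∀ {n} (L : Matrix ℕ n) {d w} → d ≤ᵥ w → Positive w → ProperMinorsPositive (DiagMinus w L) →
  ∃ λ e → e ≤ᵥ w × Eset L d e
Eset-below L {d} d≤w w>0 minors>0 = min-below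
  (λ e → Pointwise.decidable ℕP._≤?_ d e ×-dec positive? e ×-dec properMinorsPositive? (DiagMinus e L))
  (λ e≤e′ (d≤e , e>0 , minors>0) → ≤ᵥ-trans d≤e e≤e′ , positive-upwardClosed e≤e′ e>0 ,
                                     properMinorsPositive-upwardClosed L e≤e′ minors>0)
  (d≤w , w>0 , minors>0)

Fset-below : ∀ {n} (L : Matrix ℕ n) {e w} → ProperMinorsPositive (DiagMinus e L) → e ≤ᵥ w →
  0ℤ ℤ.≤ det (DiagMinus w L) → ∃ λ v → v ≤ᵥ w × Fset L e v
Fset-below L {e} e-minors>0 e≤w det≥0 = min-below
  (λ v → Pointwise.decidable ℕP._≤?_ e v ×-dec (0ℤ ℤP.≤? det (DiagMinus v L)))
  (λ {v} v≤v′ (e≤v , v-det≥0) → ≤ᵥ-trans e≤v v≤v′ , proj₂ (proj₂ (isAlmostNonsingularM-upwardClosed L v≤v′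
     (DiagMinus-isZMatrix v L , properMinorsPositive-upwardClosed L e≤v e-minors>0 , v-det≥0))))
  (e≤w , det≥0)

module Step (n : ℕ) (L : Matrix ℕ (3 + n)) where

  Candidate : Pred (Vec ℕ (3 + n)) 0ℓ
  Candidate v =
    Σ (Fin (3 + n) → Vec ℕ (3 + n)) λ δ →
      (∀ s → ∃ λ d̃ → procA n (delRC s L) d̃ × δ s ≡ insertAt d̃ s 1) ×
      ∃ λ e → Eset L (cmax δ) e × Fset L e v

  candidate⇒D≥0 : ∀ {v} → Candidate v → D≥0 L v
  candidate⇒D≥0 {v} (_ , _ , e , ((_ , e>0 , e-minors>0) , _) , ((e≤v , det≥0) , _)) =
    positive-upwardClosed e≤v e>0 , DiagMinus-isZMatrix v L ,
    properMinorsPositive-upwardClosed L e≤v e-minors>0 , det≥0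

  candidate-below : (∀ s d → procA n (delRC s L) d ⇔ Min (D≥0 (delRC s L)) d) →
    ∀ {w} → D≥0 L w → ∃ λ u → Candidate u × u ≤ᵥ w
  candidate-below IH {w} w∈D@(w>0 , _ , w-minors>0 , w-det≥0) =
    let (e , e≤w , e∈E) = Eset-below L (cmax-lub δ δ≤w) w>0 w-minors>0
        (u , u≤w , u∈F) = Fset-below L (proj₂ (proj₂ (proj₁ e∈E))) e≤w w-det≥0
    in u , (δ , (λ s → d̃ s , Equivalence.from (IH s (d̃ s)) (d̃-minimal s) , refl) , e , e∈E , u∈F) , u≤w
    where
    below-removeAt : ∀ s → ∃ λ d → d ≤ᵥ removeAt w s × Min (D≥0 (delRC s L)) d
    below-removeAt s = min-below (D≥0? (delRC s L)) (D≥0-upwardClosed (delRC s L)) (D≥0-removeAt L s w∈D)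
    d̃ : ∀ s → Vec ℕ (2 + n)
    d̃ s = proj₁ (below-removeAt s)
    d̃-minimal : ∀ s → Min (D≥0 (delRC s L)) (d̃ s)
    d̃-minimal s = proj₂ (proj₂ (below-removeAt s))
    δ : Fin (3 + n) → Vec ℕ (3 + n)
    δ s = insertAt (d̃ s) s 1
    δ≤w : ∀ s → δ s ≤ᵥ w
    δ≤w s = insertAt-≤ᵥ s (proj₁ (proj₂ (below-removeAt s))) w>0

  procA-step : (∀ s d → procA n (delRC s L) d ⇔ Min (D≥0 (delRC s L)) d) →
    ∀ v → procA (suc n) L v ⇔ Min (D≥0 L) v
  procA-step IH = Min-coinitial candidate⇒D≥0 (candidate-below IH)

theorem3p4 : (n : ℕ) (L : Matrix ℕ (2 + n)) → (∀ i → L i i ≡ 0) →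
    (v : Vec ℕ (2 + n)) → procA n L v ⇔ Min (D≥0 L) v
theorem3p4 zero    L diag≡0 = Base.procA-base L diag≡0
theorem3p4 (suc n) L diag≡0 = Step.procA-step n L (λ s → theorem3p4 n (delRC s L) (diag≡0 ∘ punchIn s))
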